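{- For any graphs $G$ and $H$, $\gamma(G\diamond H)\leq\min\{\bar{\gamma}(G),\bar{\gamma}(H)\}$.
   Context: All graphs are finite, simple and undirected; $\overline{G}$ is the complement of $G$. The modular product $G\diamond H$ has vertex set $V(G)\times V(H)$, and two distinct vertices $(g,h)$ and $(g',h')$ are adjacent iff either ($g=g'$ and $hh'\in E(H)$), or ($gg'\in E(G)$ and $h=h'$), or ($gg'\in E(G)$ and $hh'\in E(H)$), or ($g\neq g'$, $h\neq h'$, $gg'\notin E(G)$ and $hh'\notin E(H)$). $\gamma$ is the domination number. A set $D\subseteq V(G)$ is an SDCTD set of $G$ if it is a dominating set of $G$ and a total dominating set of $\overline{G}$ (every vertex of $G$ is adjacent in $\overline{G}$ to some vertex of $D$); $\bar{\gamma}(G)$ is the minimum size of an SDCTD set of $G$, taken to be $\infty$ if none exists (i.e. if $G$ has a universal vertex). -}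

module Defs where

open import Data.Nat using (ℕ; _*_; _≤_)
open import Data.Bool using (Bool; true; false; not; _∧_; _∨_; if_then_else_)
open import Data.Fin using (Fin; remQuot; _≟_)
open import Data.Fin.Subset using (Subset; _∈_; ∣_∣)
open import Data.Product using (Σ; _×_; _,_; proj₁; proj₂; ∃-syntax)
open import Relation.Nullary using (¬_)
open import Relation.Nullary.Decidable using (⌊_⌋)
open import Relation.Binary.PropositionalEquality using (_≡_)

record Graph (n : ℕ) : Set where
  field
    adj   : Fin n → Fin n → Bool
    sym   : ∀ u v → adj u v ≡ adj v u
    irref : ∀ v → adj v v ≡ false
open Graph public

cadj : ∀ {n} → Graph n → Fin n → Fin n → Bool
cadj G u v = not ⌊ u ≟ v ⌋ ∧ not (adj G u v)

complement : ∀ {n} → Graph n → Graph n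
complement {n} G = record { adj = cadj G ; sym = s ; irref = i }
  where
  open import Relation.Binary.PropositionalEquality using (refl; cong₂; cong)
  open import Relation.Nullary.Decidable using (yes; no)
  s : ∀ u v → cadj G u v ≡ cadj G v u
  s u v with u ≟ v | v ≟ u
  ... | yes _ | yes _ = refl
  ... | yes refl | no q = Data.Empty.⊥-elim (q refl)
    where import Data.Empty
  ... | no p | yes refl = Data.Empty.⊥-elim (p refl)
    where import Data.Empty
  ... | no _ | no _ = cong not (Graph.sym G u v)
  i : ∀ v → cadj G v v ≡ false
  i v with v ≟ v
  ... | yes _ = refl
  ... | no p = Data.Empty.⊥-elim (p refl)
    where import Data.Empty

-- Modular product G ◇ H on Fin (m * n); vertex k corresponds to the pair remQuot n k.
modAdj : ∀ {m n} → Graph m → Graph n → Fin m → Fin n → Fin m → Fin n → Bool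
modAdj G H g h g' h' =
     (⌊ g ≟ g' ⌋ ∧ adj H h h')
  ∨ (adj G g g' ∧ ⌊ h ≟ h' ⌋)
  ∨ (adj G g g' ∧ adj H h h')
  ∨ (cadj G g g' ∧ cadj H h h')

modAdjPair : ∀ {m n} → Graph m → Graph n → Fin (m * n) → Fin (m * n) → Bool
modAdjPair {m} {n} G H k k' =
  modAdj G H (proj₁ (remQuot {m} n k)) (proj₂ (remQuot {m} n k))
             (proj₁ (remQuot {m} n k')) (proj₂ (remQuot {m} n k'))

Adj : ∀ {n} → Graph n → Fin n → Fin n → Set
Adj G u v = adj G u v ≡ true

IsDominating : ∀ {n} → Graph n → Subset n → Set
IsDominating {n} G D = ∀ (v : Fin n) → v ∈ D Data.Sum.⊎ (∃[ u ] (u ∈ D × Adj G v u))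
  where import Data.Sum

IsTotalDominating : ∀ {n} → Graph n → Subset n → Set
IsTotalDominating {n} G D = ∀ (v : Fin n) → ∃[ u ] (u ∈ D × Adj G v u)

IsSDCTD : ∀ {n} → Graph n → Subset n → Set
IsSDCTD G D = IsDominating G D × IsTotalDominating (complement G) D

IsDominationNumber : ∀ {n} → Graph n → ℕ → Set
IsDominationNumber {n} G k =
  (∃[ D ] (IsDominating G D × ∣ D ∣ ≡ k)) × (∀ (D : Subset n) → IsDominating G D → k ≤ ∣ D ∣)

private
  module MP where
    open import Relation.Binary.PropositionalEquality using (refl; cong; cong₂; trans)
    open import Relation.Nullary.Decidable using (yes; no)
    import Data.Empty

    eqb-sym : ∀ {n} (u v : Fin n) → ⌊ u ≟ v ⌋ ≡ ⌊ v ≟ u ⌋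
    eqb-sym u v with u ≟ v | v ≟ u
    ... | yes _ | yes _ = refl
    ... | no _ | no _ = refl
    ... | yes refl | no q = Data.Empty.⊥-elim (q refl)
    ... | no p | yes refl = Data.Empty.⊥-elim (p refl)

    modAdj-sym : ∀ {m n} (G : Graph m) (H : Graph n) g h g' h'
      → modAdj G H g h g' h' ≡ modAdj G H g' h' g h
    modAdj-sym G H g h g' h'
      rewrite eqb-sym g g' | eqb-sym h h' | Graph.sym G g g' | Graph.sym H h h' = refl

    modAdj-irr : ∀ {m n} (G : Graph m) (H : Graph n) g h → modAdj G H g h g h ≡ false
    modAdj-irr G H g h
      rewrite Graph.irref G g | Graph.irref H h with g ≟ g
    ... | yes _ = refl
    ... | no p = Data.Empty.⊥-elim (p refl)

    pair-sym : ∀ {m n} (G : Graph m) (H : Graph n) k k' → modAdjPair G H k k' ≡ modAdjPair G H k' k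
    pair-sym {m} {n} G H k k' =
      modAdj-sym G H (proj₁ (remQuot {m} n k)) (proj₂ (remQuot {m} n k))
                     (proj₁ (remQuot {m} n k')) (proj₂ (remQuot {m} n k'))

    pair-irr : ∀ {m n} (G : Graph m) (H : Graph n) k → modAdjPair G H k k ≡ false
    pair-irr {m} {n} G H k = modAdj-irr G H (proj₁ (remQuot {m} n k)) (proj₂ (remQuot {m} n k))

modularProduct : ∀ {m n} → Graph m → Graph n → Graph (m * n)
modularProduct G H = record { adj = modAdjPair G H ; sym = MP.pair-sym G H ; irref = MP.pair-irr G H }

-- If D is an SDCTD set of G and h₀ is any vertex of H, then D × {h₀} dominates
-- G ◇ H. A vertex (g, h₀) is dominated along the fibre G × {h₀} because D dominates G. For
-- h ≠ h₀ with h ~ h₀, the vertex (g, h) is adjacent to (g, h₀) if g ∈ D, and to (d, h₀) if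
-- g ~ d ∈ D. For h ≠ h₀ with h ≁ h₀, totality of D in the complement of G gives d ∈ D with
-- g, d distinct and non-adjacent, so (g, h) ~ (d, h₀) by the last clause of the product.
-- The modular product is symmetric in its factors, which gives the bound by γ̄(H) as well.
module Submission where

open import Defs
open import Algebra.Bundles using (CommutativeMonoid)
open import Data.Bool using (true; false; _∧_; _∨_)
open import Data.Bool.Properties using (∧-comm; ∨-zeroʳ; ∨-commutativeMonoid)
open import Data.Fin using (Fin; zero; remQuot; combine; _≟_; _↑ˡ_; _↑ʳ_)
open import Data.Fin.Properties using (remQuot-combine; combine-remQuot)
open import Data.Fin.Subset using (Subset; inside; outside; ⊥; ⁅_⁆; _∈_; ∣_∣; Nonempty)
open import Data.Fin.Subset.Properties using (∣⊥∣≡0; ∣⁅x⁆∣≡1; x∈⁅x⁆)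
open import Data.Nat as ℕ using (ℕ; _*_; _+_; _≤_; z≤n)
open import Data.Nat.Properties
  using (≤-trans; ≤-reflexive; *-monoʳ-≤; *-monoˡ-≤; *-identityʳ; *-identityˡ; module ≤-Reasoning)
open import Data.Product using (_×_; _,_; proj₁; proj₂; ∃-syntax; Σ-syntax)
open import Data.Sum using (_⊎_; inj₁; inj₂)
open import Data.Vec using (Vec; []; _∷_; _++_; _[_]=_; here; there)
open import Relation.Binary.PropositionalEquality
  using (_≡_; _≢_; refl; cong; cong₂; trans; subst)
open import Relation.Nullary.Decidable using (yes; no; ⌊_⌋; isYes≗does; dec-true; dec-false)
open CommutativeMonoid ∨-commutativeMonoid using (commutativeSemigroup)
open import Algebra.Properties.CommutativeSemigroup commutativeSemigroup using (x∙yz≈y∙xz)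

private
  variable
    m n : ℕ

⌊x≟x⌋ : (x : Fin n) → ⌊ x ≟ x ⌋ ≡ true
⌊x≟x⌋ x = trans (isYes≗does (x ≟ x)) (dec-true (x ≟ x) refl)

≢∧¬adj⇒cadj : (K : Graph n) {u v : Fin n} → u ≢ v → adj K u v ≡ false → Adj (complement K) u v
≢∧¬adj⇒cadj K {u} {v} u≢v ¬uv
  rewrite ¬uv | isYes≗does (u ≟ v) | dec-false (u ≟ v) u≢v = refl

ModAdj : Graph m → Graph n → Fin m → Fin n → Fin m → Fin n → Set
ModAdj G H g h g′ h′ = modAdj G H g h g′ h′ ≡ true

module _ (G : Graph m) (H : Graph n) where

  modAdj-sameˡ : ∀ g {h h′} → Adj H h h′ → ModAdj G H g h g h′
  modAdj-sameˡ g hh′ rewrite ⌊x≟x⌋ g | hh′ = refl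

  modAdj-sameʳ : ∀ {g g′} h → Adj G g g′ → ModAdj G H g h g′ h
  modAdj-sameʳ h gg′ rewrite gg′ | ⌊x≟x⌋ h = ∨-zeroʳ _

  modAdj-adj : ∀ {g g′ h h′} → Adj G g g′ → Adj H h h′ → ModAdj G H g h g′ h′
  modAdj-adj {h = h} {h′} gg′ hh′ rewrite gg′ | hh′ | ∨-zeroʳ ⌊ h ≟ h′ ⌋ = ∨-zeroʳ _

  modAdj-coadj : ∀ {g g′ h h′} → Adj (complement G) g g′ → Adj (complement H) h h′ →
                 ModAdj G H g h g′ h′
  modAdj-coadj {g} {g′} {h} {h′} gg′ hh′
    rewrite gg′ | hh′ | ∨-zeroʳ (adj G g g′ ∧ adj H h h′) | ∨-zeroʳ (adj G g g′ ∧ ⌊ h ≟ h′ ⌋)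
    = ∨-zeroʳ _

  modAdj-swap : ∀ g h g′ h′ → modAdj G H g h g′ h′ ≡ modAdj H G h g h′ g′
  modAdj-swap g h g′ h′ =
    trans (x∙yz≈y∙xz (⌊ g ≟ g′ ⌋ ∧ adj H h h′) (adj G g g′ ∧ ⌊ h ≟ h′ ⌋) _)
          (cong₂ _∨_ (∧-comm (adj G g g′) _)
            (cong₂ _∨_ (∧-comm ⌊ g ≟ g′ ⌋ _)
              (cong₂ _∨_ (∧-comm (adj G g g′) _) (∧-comm (cadj G g g′) _))))

-- The product set A × B, with (g , h) at index combine g h.
infixr 7 _⊗_

_⊗_ : Subset m → Subset n → Subset (m * n)
[]            ⊗ B = []
(inside  ∷ A) ⊗ B = B ++ A ⊗ B
(outside ∷ A) ⊗ B = ⊥ ++ A ⊗ B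

∣++∣ : ∀ {k l} (p : Subset k) (q : Subset l) → ∣ p ++ q ∣ ≡ ∣ p ∣ + ∣ q ∣
∣++∣ []            q = refl
∣++∣ (inside  ∷ p) q = cong ℕ.suc (∣++∣ p q)
∣++∣ (outside ∷ p) q = ∣++∣ p q

∣⊗∣ : (A : Subset m) (B : Subset n) → ∣ A ⊗ B ∣ ≡ ∣ A ∣ * ∣ B ∣
∣⊗∣ []            B = refl
∣⊗∣ (inside  ∷ A) B = trans (∣++∣ B (A ⊗ B)) (cong (∣ B ∣ +_) (∣⊗∣ A B))
∣⊗∣ {n = n} (outside ∷ A) B =
  trans (∣++∣ (⊥ {n}) (A ⊗ B)) (cong₂ _+_ (∣⊥∣≡0 n) (∣⊗∣ A B))

∣⊗∣≤ˡ : (A : Subset m) (B : Subset n) → ∣ B ∣ ≤ 1 → ∣ A ⊗ B ∣ ≤ ∣ A ∣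
∣⊗∣≤ˡ A B ∣B∣≤1 = begin
  ∣ A ⊗ B ∣     ≡⟨ ∣⊗∣ A B ⟩
  ∣ A ∣ * ∣ B ∣ ≤⟨ *-monoʳ-≤ ∣ A ∣ ∣B∣≤1 ⟩
  ∣ A ∣ * 1     ≡⟨ *-identityʳ ∣ A ∣ ⟩
  ∣ A ∣         ∎
  where open ≤-Reasoning

∣⊗∣≤ʳ : (A : Subset m) (B : Subset n) → ∣ A ∣ ≤ 1 → ∣ A ⊗ B ∣ ≤ ∣ B ∣
∣⊗∣≤ʳ A B ∣A∣≤1 = begin
  ∣ A ⊗ B ∣     ≡⟨ ∣⊗∣ A B ⟩
  ∣ A ∣ * ∣ B ∣ ≤⟨ *-monoˡ-≤ ∣ B ∣ ∣A∣≤1 ⟩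
  1 * ∣ B ∣     ≡⟨ *-identityˡ ∣ B ∣ ⟩
  ∣ B ∣         ∎
  where open ≤-Reasoning

[]=-++⁺ˡ : ∀ {A : Set} {k l i x} {xs : Vec A k} (ys : Vec A l) →
           xs [ i ]= x → xs ++ ys [ i ↑ˡ l ]= x
[]=-++⁺ˡ ys here        = here
[]=-++⁺ˡ ys (there xsᵢ) = there ([]=-++⁺ˡ ys xsᵢ)

[]=-++⁺ʳ : ∀ {A : Set} {k l j x} (xs : Vec A k) {ys : Vec A l} →
           ys [ j ]= x → xs ++ ys [ k ↑ʳ j ]= x
[]=-++⁺ʳ []       ysⱼ = ysⱼ
[]=-++⁺ʳ (_ ∷ xs) ysⱼ = there ([]=-++⁺ʳ xs ysⱼ)

∈-⊗ : {A : Subset m} {B : Subset n} {g : Fin m} {h : Fin n} →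
      g ∈ A → h ∈ B → combine g h ∈ A ⊗ B
∈-⊗ {A = inside  ∷ A} {B}         here      h∈B = []=-++⁺ˡ (A ⊗ B) h∈B
∈-⊗ {A = inside  ∷ A} {B}         (there g∈A) h∈B = []=-++⁺ʳ B (∈-⊗ g∈A h∈B)
∈-⊗ {A = outside ∷ A}             (there g∈A) h∈B = []=-++⁺ʳ ⊥ (∈-⊗ g∈A h∈B)

ProductDominating : Graph m → Graph n → Subset m → Subset n → Set
ProductDominating {m} {n} G H A B =
  ∀ (g : Fin m) (h : Fin n) →
    (g ∈ A × h ∈ B) ⊎ (∃[ g′ ] ∃[ h′ ] (g′ ∈ A × h′ ∈ B × ModAdj G H g h g′ h′))

productDominating-swap : (G : Graph m) (H : Graph n) {A : Subset m} {B : Subset n} →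
                         ProductDominating H G B A → ProductDominating G H A B
productDominating-swap G H pd g h with pd h g
... | inj₁ (h∈B , g∈A) = inj₁ (g∈A , h∈B)
... | inj₂ (h′ , g′ , h′∈B , g′∈A , adj′) =
  inj₂ (g′ , h′ , g′∈A , h′∈B , trans (modAdj-swap G H g h g′ h′) adj′)

modAdjPair-combine : (G : Graph m) (H : Graph n) (g g′ : Fin m) (h h′ : Fin n) →
  modAdjPair G H (combine g h) (combine g′ h′) ≡ modAdj G H g h g′ h′
modAdjPair-combine G H g g′ h h′ =
  cong₂ (λ p q → modAdj G H (proj₁ p) (proj₂ p) (proj₁ q) (proj₂ q))
        (remQuot-combine g h) (remQuot-combine g′ h′)

productDominating⇒dominating : (G : Graph m) (H : Graph n) {A : Subset m} {B : Subset n} →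
  ProductDominating G H A B → IsDominating (modularProduct G H) (A ⊗ B)
productDominating⇒dominating {m} {n} G H {A} {B} pd k =
  subst Dominated (combine-remQuot {m} n k)
        (dominated (proj₁ (remQuot {m} n k)) (proj₂ (remQuot {m} n k)))
  where
  Dominated : Fin (m * n) → Set
  Dominated v = v ∈ A ⊗ B ⊎ ∃[ u ] (u ∈ A ⊗ B × Adj (modularProduct G H) v u)

  dominated : ∀ g h → Dominated (combine g h)
  dominated g h with pd g h
  ... | inj₁ (g∈A , h∈B) = inj₁ (∈-⊗ g∈A h∈B)
  ... | inj₂ (g′ , h′ , g′∈A , h′∈B , adj′) =
    inj₂ (combine g′ h′ , ∈-⊗ g′∈A h′∈B , trans (modAdjPair-combine G H g g′ h h′) adj′)

-- Requiring B to meet H only when H has a vertex covers the empty graph H as well.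
sdctd⇒productDominating : (G : Graph m) (H : Graph n) {D : Subset m} {B : Subset n} →
  IsSDCTD G D → (Fin n → Nonempty B) → ProductDominating G H D B
sdctd⇒productDominating G H (dom , tot) nonempty g h with nonempty h
... | h₀ , h₀∈B with h ≟ h₀
...   | yes refl with dom g
...     | inj₁ g∈D            = inj₁ (g∈D , h₀∈B)
...     | inj₂ (d , d∈D , gd) = inj₂ (d , h₀ , d∈D , h₀∈B , modAdj-sameʳ G H h₀ gd)
sdctd⇒productDominating G H (dom , tot) nonempty g h
  | h₀ , h₀∈B | no h≢h₀ with adj H h h₀ in hh₀
...     | false = let d , d∈D , gd = tot g in
                  inj₂ (d , h₀ , d∈D , h₀∈B , modAdj-coadj G H gd (≢∧¬adj⇒cadj H h≢h₀ hh₀))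
...     | true with dom g
...       | inj₁ g∈D            = inj₂ (g , h₀ , g∈D , h₀∈B , modAdj-sameˡ G H g hh₀)
...       | inj₂ (d , d∈D , gd) = inj₂ (d , h₀ , d∈D , h₀∈B , modAdj-adj G H gd hh₀)

pointIfInhabited : ∀ n → Σ[ B ∈ Subset n ] (∣ B ∣ ≤ 1 × (Fin n → Nonempty B))
pointIfInhabited ℕ.zero    = ⊥ , z≤n , λ ()
pointIfInhabited (ℕ.suc n) = ⁅ zero ⁆ , ≤-reflexive (∣⁅x⁆∣≡1 (zero {n})) , λ _ → zero , x∈⁅x⁆ zero

SmallDominatingSet : Graph m → ℕ → Set
SmallDominatingSet {m} G k = Σ[ S ∈ Subset m ] (IsDominating G S × ∣ S ∣ ≤ k)

sdctdˡ⇒smallDominatingSet : (G : Graph m) (H : Graph n) {D : Subset m} →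
  IsSDCTD G D → SmallDominatingSet (modularProduct G H) ∣ D ∣
sdctdˡ⇒smallDominatingSet {n = n} G H {D} sd =
  let B , ∣B∣≤1 , nonempty = pointIfInhabited n in
  D ⊗ B ,
  productDominating⇒dominating G H (sdctd⇒productDominating G H sd nonempty) ,
  ∣⊗∣≤ˡ D B ∣B∣≤1

sdctdʳ⇒smallDominatingSet : (G : Graph m) (H : Graph n) {D : Subset n} →
  IsSDCTD H D → SmallDominatingSet (modularProduct G H) ∣ D ∣
sdctdʳ⇒smallDominatingSet {m = m} G H {D} sd =
  let A , ∣A∣≤1 , nonempty = pointIfInhabited m in
  A ⊗ D ,
  productDominating⇒dominating G H
    (productDominating-swap G H (sdctd⇒productDominating H G sd nonempty)) ,
  ∣⊗∣≤ʳ A D ∣A∣≤1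

proposition14 : ∀ {m n : ℕ} (G : Graph m) (H : Graph n) (k : ℕ)
    → IsDominationNumber (modularProduct G H) k
    → (∀ (D : Subset m) → IsSDCTD G D → k ≤ ∣ D ∣)
      × (∀ (D : Subset n) → IsSDCTD H D → k ≤ ∣ D ∣)
proposition14 G H k (_ , minimal) =
  (λ _ sd → bounded (sdctdˡ⇒smallDominatingSet G H sd)) ,
  (λ _ sd → bounded (sdctdʳ⇒smallDominatingSet G H sd))
  where
  bounded : ∀ {l} → SmallDominatingSet (modularProduct G H) l → k ≤ l
  bounded (S , dom , ∣S∣≤l) = ≤-trans (minimal S dom) ∣S∣≤l
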